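{- Let $G_{A,B}=(A,B,E)$ be an unweighted undirected bipartite graph and let $G$ be obtained from it by adding a vertex $s$ adjacent to every vertex of $A$ and a vertex $t$ adjacent to every vertex of $B$. Then the minimum vertex cover of $G$ has size at most $OPT+2$, where $OPT$ is the size (number of edges) of the minimum $s$-$t$ cut in $G$. -}

module Defs where

open import Data.Nat using (ℕ; _≤_; _+_)
open import Data.Fin using (Fin)
open import Data.Bool using (Bool; T)
open import Data.List using (List; length)
open import Data.List.Membership.Propositional using (_∈_)
open import Data.List.Relation.Unary.Unique.Propositional using (Unique)
open import Data.Product using (Σ; _×_; _,_; proj₁; proj₂)
open import Data.Sum using (_⊎_)
open import Relation.Nullary using (¬_)
open import Relation.Binary.PropositionalEquality using (_≡_)

BipGraph : ℕ → ℕ → Set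
BipGraph m n = Fin m → Fin n → Bool

data Vertex (m n : ℕ) : Set where
  s : Vertex m n
  t : Vertex m n
  vA : Fin m → Vertex m n
  vB : Fin n → Vertex m n

data Edge {m n : ℕ} (E : BipGraph m n) : Set where
  sa : Fin m → Edge E
  bt : Fin n → Edge E
  ab : (i : Fin m) (j : Fin n) → T (E i j) → Edge E

endpoints : ∀ {m n} {E : BipGraph m n} → Edge E → Vertex m n × Vertex m n
endpoints (sa i) = s , vA i
endpoints (bt j) = vB j , t
endpoints (ab i j _) = vA i , vB j

Joins : ∀ {m n} {E : BipGraph m n} → Edge E → Vertex m n → Vertex m n → Set
Joins e u v with endpoints e
... | x , y = (x ≡ u × y ≡ v) ⊎ (x ≡ v × y ≡ u)

data Walk {m n : ℕ} {E : BipGraph m n} (C : List (Edge E)) :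
          Vertex m n → Vertex m n → Set where
  here : ∀ {u} → Walk C u u
  step : ∀ {u w v} (e : Edge E) → ¬ (e ∈ C) → Joins e u w →
         Walk C w v → Walk C u v

IsSTCut : ∀ {m n} {E : BipGraph m n} → List (Edge E) → Set
IsSTCut {E = E} C = Unique C × ¬ Walk {E = E} C s t

IsMinSTCut : ∀ {m n} {E : BipGraph m n} → List (Edge E) → Set
IsMinSTCut {E = E} C =
  IsSTCut C × (∀ (C' : List (Edge E)) → IsSTCut C' → length C ≤ length C')

IsVertexCover : ∀ {m n} (E : BipGraph m n) → List (Vertex m n) → Set
IsVertexCover E X =
  Unique X × (∀ (e : Edge E) → proj₁ (endpoints e) ∈ X ⊎ proj₂ (endpoints e) ∈ X)

-- Put s, t and, for every cut edge, its endpoint other than s and t (the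
-- A-end for an A–B edge) into the cover.  An A–B edge {a,b} left uncovered
-- would have neither {s,a}, {a,b} nor {b,t} in the cut, so s a b t would be
-- an s-t path avoiding the cut.
module Submission where

open import Defs
open import Data.Bool using (T)
open import Data.Nat using (ℕ; _≤_; _+_)
open import Data.Nat.Properties using (≤-trans; ≤-reflexive; +-comm)
open import Data.List using (List; length; _∷_; map; deduplicate)
open import Data.List.Properties using (length-deduplicate; length-map)
open import Data.List.Membership.Propositional using (_∈_; _∉_)
open import Data.List.Membership.Propositional.Properties using (∈-map⁺; ∈-deduplicate⁺)
open import Data.List.Relation.Unary.Any using (here; there)
open import Data.List.Relation.Unary.Unique.DecPropositional.Properties using (deduplicate-!)
open import Data.Product using (Σ; _×_; _,_; proj₁; proj₂)
open import Data.Sum using (_⊎_; inj₁; inj₂) renaming (map to ⊎-map)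
open import Data.Empty using (⊥-elim)
open import Function using (_∘_)
import Data.Fin.Properties as Fin
open import Relation.Nullary using (¬_; yes; no)
open import Relation.Binary.Definitions using (DecidableEquality)
open import Relation.Binary.PropositionalEquality using (refl; cong; trans)

module _ {m n : ℕ} where

  _≟_ : DecidableEquality (Vertex m n)
  s ≟ s = yes refl
  t ≟ t = yes refl
  vA i ≟ vA j with i Fin.≟ j
  ... | yes refl = yes refl
  ... | no i≢j = no λ { refl → i≢j refl }
  vB i ≟ vB j with i Fin.≟ j
  ... | yes refl = yes refl
  ... | no i≢j = no λ { refl → i≢j refl }
  s ≟ t = no λ ()
  s ≟ vA _ = no λ ()
  s ≟ vB _ = no λ ()
  t ≟ s = no λ ()
  t ≟ vA _ = no λ ()
  t ≟ vB _ = no λ ()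
  vA _ ≟ s = no λ ()
  vA _ ≟ t = no λ ()
  vA _ ≟ vB _ = no λ ()
  vB _ ≟ s = no λ ()
  vB _ ≟ t = no λ ()
  vB _ ≟ vA _ = no λ ()

  Covers : ∀ {E : BipGraph m n} → List (Vertex m n) → Edge E → Set
  Covers X e = proj₁ (endpoints e) ∈ X ⊎ proj₂ (endpoints e) ∈ X

  deduplicate-isVertexCover : ∀ {E : BipGraph m n} (L : List (Vertex m n)) →
    (∀ e → Covers L e) → IsVertexCover E (deduplicate _≟_ L)
  deduplicate-isVertexCover L cover =
    deduplicate-! _≟_ L , λ e → ⊎-map ∈-dedup ∈-dedup (cover e)
    where
    ∈-dedup : ∀ {v} → v ∈ L → v ∈ deduplicate _≟_ L
    ∈-dedup = ∈-deduplicate⁺ _≟_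

module _ {m n : ℕ} {E : BipGraph m n} where

  innerEndpoint : Edge E → Vertex m n
  innerEndpoint (sa i) = vA i
  innerEndpoint (bt j) = vB j
  innerEndpoint (ab i _ _) = vA i

  walk-s-a-b-t : ∀ {C : List (Edge E)} {i j} (p : T (E i j)) →
    sa i ∉ C → ab i j p ∉ C → bt j ∉ C → Walk C s t
  walk-s-a-b-t {i = i} {j} p sa∉C ab∉C bt∉C =
    step (sa i) sa∉C (inj₁ (refl , refl))
      (step (ab i j p) ab∉C (inj₁ (refl , refl))
        (step (bt j) bt∉C (inj₁ (refl , refl)) here))

  open import Data.List.Membership.DecPropositional (_≟_ {m} {n}) using (_∈?_)

  cut-covers : ∀ {C : List (Edge E)} → ¬ Walk C s t →
    ∀ e → Covers (s ∷ t ∷ map innerEndpoint C) e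
  cut-covers _ (sa i) = inj₁ (here refl)
  cut-covers _ (bt j) = inj₂ (there (here refl))
  cut-covers {C} noWalk (ab i j p) with vA i ∈? map innerEndpoint C | vB j ∈? map innerEndpoint C
  ... | yes a∈ | _ = inj₁ (there (there a∈))
  ... | no _ | yes b∈ = inj₂ (there (there b∈))
  ... | no a∉ | no b∉ =
    ⊥-elim (noWalk (walk-s-a-b-t p (a∉ ∘ inner∈) (a∉ ∘ inner∈) (b∉ ∘ inner∈)))
    where
    inner∈ : ∀ {e} → e ∈ C → innerEndpoint e ∈ map innerEndpoint C
    inner∈ = ∈-map⁺ innerEndpoint

lemma3p1 : ∀ {m n : ℕ} (E : BipGraph m n) (C : List (Edge E)) →
           IsMinSTCut C →
           Σ (List (Vertex m n)) (λ X → IsVertexCover E X × length X ≤ length C + 2)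
lemma3p1 {m} {n} E C ((_ , noWalk) , _) =
  deduplicate _≟_ L , deduplicate-isVertexCover L (cut-covers noWalk) , size
  where
  L : List (Vertex m n)
  L = s ∷ t ∷ map innerEndpoint C
  size : length (deduplicate _≟_ L) ≤ length C + 2
  size = ≤-trans (length-deduplicate _≟_ L)
    (≤-reflexive (trans (cong (2 +_) (length-map innerEndpoint C)) (+-comm 2 (length C))))
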